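{- Let $\mathcal{B}$ be a preorder on $SC$. Then $\rho\models_{\mathcal{B}}\mathrm{dual}(\rho)$ for every $\rho\in SC$, where $\mathrm{dual}(\rho)=\overline{\mathrm{mcl}(\rho)}$.
   Context: Fix a set $BT$ of base types with a preorder $\le_:$ and a countable set of labels. Contract terms: $\sigma ::= \mathbf{1} \mid ?t.\sigma \mid !t.\sigma \mid ?(\sigma').\sigma \mid !(\sigma').\sigma \mid \sum_{i\in I} ?l_i.\sigma_i \mid \bigoplus_{i\in I} !l_i.\sigma_i \mid \mu x.\sigma \mid x$ ($t\in BT$, $I$ finite nonempty, labels distinct; $!l.\sigma$ is the one-summand internal sum). $SC$ is the set of closed guarded terms (guarded: for every subterm $\mu x.\sigma$, every occurrence of $x$ in $\sigma$ lies under a constructor other than $\mu$). Transitions: $\mathbf{1}\xrightarrow{\mathsf{ok}}$; $\lambda.\sigma\xrightarrow{\lambda}\sigma$ for prefixes $\lambda\in\{?l,!l,?t,!t,?(\sigma'),!(\sigma')\}$; $\sum_{i\in I}?l_i.\sigma_i\xrightarrow{?l_k}\sigma_k$; $\bigoplus_{i\in I}!l_i.\sigma_i\xrightarrow{\tau}!l_k.\sigma_k$ when $|I|>1$; $\mu x.\sigma\xrightarrow{\tau}\sigma\{\mu x.\sigma/x\}$; nothing else. $\lambda_1\bowtie_{\mathcal{B}}\lambda_2$ iff $(\lambda_1,\lambda_2)$ is $(!l,?l)$, $(?l,!l)$, $(!t_1,?t_2)$ with $t_1\le_:t_2$, $(?t_1,!t_2)$ with $t_2\le_:t_1$, $(!(\sigma_1),?(\sigma_2))$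 with $\sigma_1\mathcal{B}\sigma_2$, or $(?(\sigma_1),!(\sigma_2))$ with $\sigma_2\mathcal{B}\sigma_1$. $\rho\mid\sigma\xrightarrow{\tau}_{\mathcal{B}}\rho'\mid\sigma'$ iff $\rho\xrightarrow{\tau}\rho'$, $\sigma'=\sigma$; or $\sigma\xrightarrow{\tau}\sigma'$, $\rho'=\rho$; or $\rho\xrightarrow{\lambda_1}\rho'$, $\sigma\xrightarrow{\lambda_2}\sigma'$, $\lambda_1\bowtie_{\mathcal{B}}\lambda_2$. $\models_{\mathcal{B}}$ is the largest relation $R$ on $SC$ such that whenever $\rho R\sigma$: (i) if $\rho\mid\sigma$ has no $\tau$-transition w.r.t. $\mathcal{B}$ then $\rho\xrightarrow{\mathsf{ok}}$, $\sigma\xrightarrow{\mathsf{ok}}$; (ii) $\rho\mid\sigma\xrightarrow{\tau}_{\mathcal{B}}\rho'\mid\sigma'$ implies $\rho'R\sigma'$. Standard dual: $\overline{\mathbf{1}}=\mathbf{1}$, $\overline{x}=x$, $\overline{\mu x.\sigma}=\mu x.\overline{\sigma}$, $\overline{?t.\sigma}=!t.\overline{\sigma}$, $\overline{!t.\sigma}=?t.\overline{\sigma}$, $\overline{?(\sigma^m).\sigma}=!(\sigma^m).\overline{\sigma}$, $\overline{!(\sigma^m).\sigma}=?(\sigma^m).\overline{\sigma}$ (messages unchanged), $\overline{\sum_i?l_i.\sigma_i}=\bigoplus_i!l_i.\overline{\sigma_i}$, $\overline{\bigoplus_i!l_i.\sigma_i}=\sum_i?l_i.\overline{\sigma_i}$.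 Substitutions $s$ are finite partial maps from variables to closed terms, applied to free occurrences (with $(\mu y.\rho)s=\mu y.(\rho s')$, $s'$ being $s$ with $y$ removed). $\mathrm{mclo}(\sigma,s)$ (for $\mathrm{fv}(\sigma)\subseteq\mathrm{dom}(s)$): $\mathbf{1}\mapsto\mathbf{1}$; $x\mapsto x$; $!(\sigma^m).\sigma'\mapsto!(\sigma^m s).\mathrm{mclo}(\sigma',s)$; $?(\sigma^m).\sigma'\mapsto?(\sigma^m s).\mathrm{mclo}(\sigma',s)$; $?t.\sigma'\mapsto?t.\mathrm{mclo}(\sigma',s)$; $!t.\sigma'\mapsto!t.\mathrm{mclo}(\sigma',s)$; $\sum_i?l_i.\sigma_i\mapsto\sum_i?l_i.\mathrm{mclo}(\sigma_i,s)$; $\bigoplus_i!l_i.\sigma_i\mapsto\bigoplus_i!l_i.\mathrm{mclo}(\sigma_i,s)$; $\mu x.\sigma'\mapsto\mu x.\mathrm{mclo}(\sigma',s')$ where $s'$ maps $x$ to $(\mu x.\sigma')s$ and agrees with $s$ elsewhere. $\mathrm{mcl}(\sigma)=\mathrm{mclo}(\sigma,\varepsilon)$ for $\sigma\in SC$, $\varepsilon$ the empty substitution. -}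

module Defs where

open import Level using (0ℓ)
open import Data.Nat using (ℕ; _≟_)
open import Data.Maybe using (Maybe; just; nothing)
open import Data.List using (List; []; _∷_)
open import Data.List.Relation.Unary.Unique.Propositional using (Unique)
open import Data.Product using (Σ; _×_; _,_)
open import Relation.Nullary using (¬_; does)
open import Relation.Binary.PropositionalEquality using (_≡_; _≢_)
open import Data.Bool using (if_then_else_)

Var : Set
Var = ℕ

Label : Set
Label = ℕ

-- Everything is parametrised by the set BT of base types and its
-- (pre)order _≤ₜ_ (the preorder hypothesis is stated in the theorem).
module Contracts (BT : Set) (_≤ₜ_ : BT → BT → Set) where

  mutual
    data Term : Set where
      𝟏    : Term
      ?t   : BT → Term → Term
      !t   : BT → Term → Term
      ?m   : Term → Term → Term
      !m   : Term → Term → Term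
      ext  : Sum → Term
      int  : Sum → Term                -- ⊕_{i∈I} !l_i.σ_i   (!l.σ = int (last l σ))
      μ    : Var → Term → Term
      var  : Var → Term

    data Sum : Set where
      last : Label → Term → Sum
      cons : Label → Term → Sum → Sum

  labels : Sum → List Label
  labels (last l _) = l ∷ []
  labels (cons l _ s) = l ∷ labels s

  data _∋_⇒_ : Sum → Label → Term → Set where
    here-last : ∀ {l σ} → last l σ ∋ l ⇒ σ
    here-cons : ∀ {l σ s} → cons l σ s ∋ l ⇒ σ
    there     : ∀ {l σ l' σ' s} → s ∋ l ⇒ σ → cons l' σ' s ∋ l ⇒ σ

  mutual
    data FreeIn (x : Var) : Term → Set where
      var  : FreeIn x (var x)
      ?t   : ∀ {t σ} → FreeIn x σ → FreeIn x (?t t σ)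
      !t   : ∀ {t σ} → FreeIn x σ → FreeIn x (!t t σ)
      ?m₁  : ∀ {m σ} → FreeIn x m → FreeIn x (?m m σ)
      ?m₂  : ∀ {m σ} → FreeIn x σ → FreeIn x (?m m σ)
      !m₁  : ∀ {m σ} → FreeIn x m → FreeIn x (!m m σ)
      !m₂  : ∀ {m σ} → FreeIn x σ → FreeIn x (!m m σ)
      ext  : ∀ {s} → FreeInSum x s → FreeIn x (ext s)
      int  : ∀ {s} → FreeInSum x s → FreeIn x (int s)
      μ    : ∀ {y σ} → x ≢ y → FreeIn x σ → FreeIn x (μ y σ)

    data FreeInSum (x : Var) : Sum → Set where
      last  : ∀ {l σ} → FreeIn x σ → FreeInSum x (last l σ)
      cons₁ : ∀ {l σ s} → FreeIn x σ → FreeInSum x (cons l σ s)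
      cons₂ : ∀ {l σ s} → FreeInSum x s → FreeInSum x (cons l σ s)

  Closed : Term → Set
  Closed σ = ∀ x → ¬ FreeIn x σ

  data Unguarded (x : Var) : Term → Set where
    var : Unguarded x (var x)
    μ   : ∀ {y σ} → x ≢ y → Unguarded x σ → Unguarded x (μ y σ)

  mutual
    data WF : Term → Set where
      𝟏   : WF 𝟏
      ?t  : ∀ {t σ} → WF σ → WF (?t t σ)
      !t  : ∀ {t σ} → WF σ → WF (!t t σ)
      ?m  : ∀ {m σ} → WF m → WF σ → WF (?m m σ)
      !m  : ∀ {m σ} → WF m → WF σ → WF (!m m σ)
      ext : ∀ {s} → Unique (labels s) → WFSum s → WF (ext s)
      int : ∀ {s} → Unique (labels s) → WFSum s → WF (int s)
      μ   : ∀ {x σ} → ¬ Unguarded x σ → WF σ → WF (μ x σ)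
      var : ∀ {x} → WF (var x)

    data WFSum : Sum → Set where
      last : ∀ {l σ} → WF σ → WFSum (last l σ)
      cons : ∀ {l σ s} → WF σ → WFSum s → WFSum (cons l σ s)

  SC : Term → Set
  SC σ = Closed σ × WF σ

  Subst : Set
  Subst = Var → Maybe Term

  ε : Subst
  ε _ = nothing

  remove : Subst → Var → Subst
  remove s y x = if does (x ≟ y) then nothing else s x

  update : Subst → Var → Term → Subst
  update s y u x = if does (x ≟ y) then just u else s x

  [_↦_] : Var → Term → Subst
  [ y ↦ u ] = update ε y u

  lookupVar : Maybe Term → Var → Term
  lookupVar (just u) _ = u
  lookupVar nothing x = var x

  mutual
    _⟨_⟩ : Term → Subst → Term
    𝟏 ⟨ s ⟩ = 𝟏
    ?t t σ ⟨ s ⟩ = ?t t (σ ⟨ s ⟩)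
    !t t σ ⟨ s ⟩ = !t t (σ ⟨ s ⟩)
    ?m m σ ⟨ s ⟩ = ?m (m ⟨ s ⟩) (σ ⟨ s ⟩)
    !m m σ ⟨ s ⟩ = !m (m ⟨ s ⟩) (σ ⟨ s ⟩)
    ext b ⟨ s ⟩ = ext (b ⟨ s ⟩ₛ)
    int b ⟨ s ⟩ = int (b ⟨ s ⟩ₛ)
    μ y σ ⟨ s ⟩ = μ y (σ ⟨ remove s y ⟩)
    var x ⟨ s ⟩ = lookupVar (s x) x

    _⟨_⟩ₛ : Sum → Subst → Sum
    last l σ ⟨ s ⟩ₛ = last l (σ ⟨ s ⟩)
    cons l σ b ⟨ s ⟩ₛ = cons l (σ ⟨ s ⟩) (b ⟨ s ⟩ₛ)

  mutual
    mclo : Term → Subst → Term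
    mclo 𝟏 s = 𝟏
    mclo (var x) s = var x
    mclo (!m m σ) s = !m (m ⟨ s ⟩) (mclo σ s)
    mclo (?m m σ) s = ?m (m ⟨ s ⟩) (mclo σ s)
    mclo (?t t σ) s = ?t t (mclo σ s)
    mclo (!t t σ) s = !t t (mclo σ s)
    mclo (ext b) s = ext (mcloₛ b s)
    mclo (int b) s = int (mcloₛ b s)
    mclo (μ x σ) s = μ x (mclo σ (update s x (μ x σ ⟨ s ⟩)))

    mcloₛ : Sum → Subst → Sum
    mcloₛ (last l σ) s = last l (mclo σ s)
    mcloₛ (cons l σ b) s = cons l (mclo σ s) (mcloₛ b s)

  mcl : Term → Term
  mcl σ = mclo σ ε

  mutual
    dual : Term → Term
    dual 𝟏 = 𝟏
    dual (var x) = var x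
    dual (μ x σ) = μ x (dual σ)
    dual (?t t σ) = !t t (dual σ)
    dual (!t t σ) = ?t t (dual σ)
    dual (?m m σ) = !m m (dual σ)
    dual (!m m σ) = ?m m (dual σ)
    dual (ext b) = int (dualₛ b)
    dual (int b) = ext (dualₛ b)

    dualₛ : Sum → Sum
    dualₛ (last l σ) = last l (dual σ)
    dualₛ (cons l σ b) = cons l (dual σ) (dualₛ b)

  data Act : Set where
    τ    : Act
    inL  : Label → Act
    outL : Label → Act
    inT  : BT → Act
    outT : BT → Act
    inM  : Term → Act
    outM : Term → Act

  data CanOk : Term → Set where
    ok : CanOk 𝟏

  data _—[_]→_ : Term → Act → Term → Set where
    ?t   : ∀ {t σ} → ?t t σ —[ inT t ]→ σ
    !t   : ∀ {t σ} → !t t σ —[ outT t ]→ σ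
    ?m   : ∀ {m σ} → ?m m σ —[ inM m ]→ σ
    !m   : ∀ {m σ} → !m m σ —[ outM m ]→ σ
    !l   : ∀ {l σ} → int (last l σ) —[ outL l ]→ σ
    ext  : ∀ {b l σ} → b ∋ l ⇒ σ → ext b —[ inL l ]→ σ
    int  : ∀ {l₀ σ₀ b l σ} → cons l₀ σ₀ b ∋ l ⇒ σ →
           int (cons l₀ σ₀ b) —[ τ ]→ int (last l σ)
    unf  : ∀ {x σ} → μ x σ —[ τ ]→ (σ ⟨ [ x ↦ μ x σ ] ⟩)

  data Match (B : Term → Term → Set) : Act → Act → Set where
    !l?l : ∀ {l} → Match B (outL l) (inL l)
    ?l!l : ∀ {l} → Match B (inL l) (outL l)
    !t?t : ∀ {t₁ t₂} → t₁ ≤ₜ t₂ → Match B (outT t₁) (inT t₂)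
    ?t!t : ∀ {t₁ t₂} → t₂ ≤ₜ t₁ → Match B (inT t₁) (outT t₂)
    !m?m : ∀ {σ₁ σ₂} → B σ₁ σ₂ → Match B (outM σ₁) (inM σ₂)
    ?m!m : ∀ {σ₁ σ₂} → B σ₂ σ₁ → Match B (inM σ₁) (outM σ₂)

  data PairStep (B : Term → Term → Set) (ρ σ : Term) : Term → Term → Set where
    left  : ∀ {ρ'} → ρ —[ τ ]→ ρ' → PairStep B ρ σ ρ' σ
    right : ∀ {σ'} → σ —[ τ ]→ σ' → PairStep B ρ σ ρ σ'
    sync  : ∀ {ρ' σ' a b} → ρ —[ a ]→ ρ' → σ —[ b ]→ σ' → Match B a b →
            PairStep B ρ σ ρ' σ'

  IsCompliance : (B R : Term → Term → Set) → Set
  IsCompliance B R = ∀ {ρ σ} → R ρ σ →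
      (SC ρ × SC σ)
    × ((∀ ρ' σ' → ¬ PairStep B ρ σ ρ' σ') → CanOk ρ × CanOk σ)
    × (∀ {ρ' σ'} → PairStep B ρ σ ρ' σ' → R ρ' σ')

  -- ⊨_B : the largest such relation (union of all of them)
  _⊨[_]_ : Term → (Term → Term → Set) → Term → Set₁
  ρ ⊨[ B ] σ = Σ (Term → Term → Set) λ R → IsCompliance B R × R ρ σ

  IsPreorderOnSC : (Term → Term → Set) → Set
  IsPreorderOnSC B =
      (∀ {a b} → B a b → SC a × SC b)
    × (∀ {a} → SC a → B a a)
    × (∀ {a b c} → B a b → B b c → B a c)

-- Write dualᵐ ρ for dual (mcl ρ); it mirrors ρ action by action, so compliance is
-- witnessed by pairing each state ρ' of ρ with dualᵐ ρ'. The crux is that dualᵐ commutes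
-- with unfolding: mcl has already closed every message under the substitution in force,
-- so substituting dualᵐ (μ x σ) for x in the body of dualᵐ (μ x σ) leaves the messages
-- alone and yields dualᵐ (σ{μ x σ / x}). Each side unfolds and resolves internal choices
-- on its own, so the pair may drift apart, but only by unfoldings or by one pending
-- choice; in each such configuration some move is possible, so a stuck pair is 𝟏 ∣ 𝟏.
-- Synchronising on messages and base types only uses reflexivity of B and of ≤ₜ.
module Submission where

open import Defs
open import Data.Bool using (true; false)
open import Data.Nat using (_≟_; _≡ᵇ_)
open import Data.Maybe using (just; nothing; _<∣>_) renaming (map to mapᴹ)
open import Data.Maybe.Properties using (just-injective; <∣>-identityʳ)
open import Data.List using (_∷_)
open import Data.List.Relation.Unary.All using ([]) renaming (lookup to All-lookup)
open import Data.List.Relation.Unary.Any using (here; there)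
open import Data.List.Membership.Propositional using (_∈_)
open import Data.List.Relation.Unary.Unique.Propositional using (Unique; []; _∷_)
open import Data.Product as Product using (∃; ∃₂; ∃-syntax; _×_; _,_; proj₁; proj₂)
open import Data.Sum as Sum using (_⊎_; inj₁; inj₂)
open import Data.Empty using (⊥-elim)
open import Function using (_∘_)
open import Relation.Nullary using (¬_; yes; no; contradiction)
open import Relation.Nullary.Decidable using (dec-true; dec-false)
open import Relation.Binary.PropositionalEquality
open ≡-Reasoning
open import Relation.Binary.Structures using (IsPreorder)

module Duality (BT : Set) (_≤ₜ_ : BT → BT → Set) where
  open Contracts BT _≤ₜ_

  remove-≡ : ∀ s y → remove s y y ≡ nothing
  remove-≡ s y rewrite dec-true (y ≟ y) refl = refl

  remove-≢ : ∀ s {y x} → x ≢ y → remove s y x ≡ s x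
  remove-≢ s {y} {x} x≢y rewrite dec-false (x ≟ y) x≢y = refl

  update-≡ : ∀ s y X → update s y X y ≡ just X
  update-≡ s y X rewrite dec-true (y ≟ y) refl = refl

  update-≢ : ∀ s {y} X {x} → x ≢ y → update s y X x ≡ s x
  update-≢ s {y} X {x} x≢y rewrite dec-false (x ≟ y) x≢y = refl

  remove-just : ∀ s y x {v} → remove s y x ≡ just v → x ≢ y × s x ≡ just v
  remove-just s y x e with x ≟ y
  ... | yes refl = contradiction (trans (sym (remove-≡ s x)) e) λ ()
  ... | no x≢y = x≢y , trans (sym (remove-≢ s x≢y)) e

  -- remove and update test does (x ≟ y), which computes to x ≡ᵇ y: splitting on the
  -- boolean makes both sides of such pointwise equations reduce.
  remove-nothing : ∀ s y x → s x ≡ nothing → remove s y x ≡ nothing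
  remove-nothing s y x e with x ≡ᵇ y
  ... | true = refl
  ... | false = e

  update-just : ∀ s y X x {v} → update s y X x ≡ just v →
                (x ≡ y × v ≡ X) ⊎ (x ≢ y × s x ≡ just v)
  update-just s y X x e with x ≟ y
  ... | yes refl = inj₁ (refl , just-injective (trans (sym e) (update-≡ s x X)))
  ... | no x≢y = inj₂ (x≢y , trans (sym (update-≢ s X x≢y)) e)

  ↦-just : ∀ y X x {v} → [ y ↦ X ] x ≡ just v → v ≡ X
  ↦-just y X x e with update-just ε y X x e
  ... | inj₁ (_ , v≡X) = v≡X

  remove-cong : ∀ s s' y x → (x ≢ y → s x ≡ s' x) → remove s y x ≡ remove s' y x
  remove-cong s s' y x h with x ≟ y
  ... | yes refl = trans (remove-≡ s x) (sym (remove-≡ s' x))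
  ... | no x≢y = trans (remove-≢ s x≢y) (trans (h x≢y) (sym (remove-≢ s' x≢y)))

  update-cong : ∀ s s' {X X'} y x → X ≡ X' → (x ≢ y → s x ≡ s' x) →
                update s y X x ≡ update s' y X' x
  update-cong s s' {X} y x refl h with x ≟ y
  ... | yes refl = trans (update-≡ s x X) (sym (update-≡ s' x X))
  ... | no x≢y = trans (update-≢ s X x≢y) (trans (h x≢y) (sym (update-≢ s' X x≢y)))

  Fv : Term → Var → Set
  Fv t x = FreeIn x t

  Fvₛ : Sum → Var → Set
  Fvₛ b x = FreeInSum x b

  mutual
    ⟨⟩-cong : ∀ t {s s'} → (∀ x → FreeIn x t → s x ≡ s' x) → t ⟨ s ⟩ ≡ t ⟨ s' ⟩
    ⟨⟩-cong 𝟏 h = refl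
    ⟨⟩-cong (?t t σ) h = cong (?t t) (⟨⟩-cong σ (λ x f → h x (?t f)))
    ⟨⟩-cong (!t t σ) h = cong (!t t) (⟨⟩-cong σ (λ x f → h x (!t f)))
    ⟨⟩-cong (?m m σ) h = cong₂ ?m (⟨⟩-cong m (λ x f → h x (?m₁ f))) (⟨⟩-cong σ (λ x f → h x (?m₂ f)))
    ⟨⟩-cong (!m m σ) h = cong₂ !m (⟨⟩-cong m (λ x f → h x (!m₁ f))) (⟨⟩-cong σ (λ x f → h x (!m₂ f)))
    ⟨⟩-cong (ext b) h = cong ext (⟨⟩ₛ-cong b (λ x f → h x (ext f)))
    ⟨⟩-cong (int b) h = cong int (⟨⟩ₛ-cong b (λ x f → h x (int f)))
    ⟨⟩-cong (μ y σ) {s} {s'} h =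
      cong (μ y) (⟨⟩-cong σ λ x f → remove-cong s s' y x λ x≢y → h x (μ x≢y f))
    ⟨⟩-cong (var x) h = cong (λ m → lookupVar m x) (h x var)

    ⟨⟩ₛ-cong : ∀ b {s s'} → (∀ x → FreeInSum x b → s x ≡ s' x) → b ⟨ s ⟩ₛ ≡ b ⟨ s' ⟩ₛ
    ⟨⟩ₛ-cong (last l σ) h = cong (last l) (⟨⟩-cong σ (λ x f → h x (last f)))
    ⟨⟩ₛ-cong (cons l σ b) h =
      cong₂ (cons l) (⟨⟩-cong σ (λ x f → h x (cons₁ f))) (⟨⟩ₛ-cong b (λ x f → h x (cons₂ f)))

  remove-ε : ∀ y x → remove ε y x ≡ nothing
  remove-ε y x = remove-nothing ε y x refl

  mutual
    ⟨ε⟩ : ∀ t → t ⟨ ε ⟩ ≡ t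
    ⟨ε⟩ 𝟏 = refl
    ⟨ε⟩ (?t t σ) = cong (?t t) (⟨ε⟩ σ)
    ⟨ε⟩ (!t t σ) = cong (!t t) (⟨ε⟩ σ)
    ⟨ε⟩ (?m m σ) = cong₂ ?m (⟨ε⟩ m) (⟨ε⟩ σ)
    ⟨ε⟩ (!m m σ) = cong₂ !m (⟨ε⟩ m) (⟨ε⟩ σ)
    ⟨ε⟩ (ext b) = cong ext (⟨ε⟩ₛ b)
    ⟨ε⟩ (int b) = cong int (⟨ε⟩ₛ b)
    ⟨ε⟩ (μ y σ) = cong (μ y) (trans (⟨⟩-cong σ λ x _ → remove-ε y x) (⟨ε⟩ σ))
    ⟨ε⟩ (var x) = refl

    ⟨ε⟩ₛ : ∀ b → b ⟨ ε ⟩ₛ ≡ b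
    ⟨ε⟩ₛ (last l σ) = cong (last l) (⟨ε⟩ σ)
    ⟨ε⟩ₛ (cons l σ b) = cong₂ (cons l) (⟨ε⟩ σ) (⟨ε⟩ₛ b)

  ⟨⟩-identity : ∀ t {s} → (∀ x → FreeIn x t → s x ≡ nothing) → t ⟨ s ⟩ ≡ t
  ⟨⟩-identity t h = trans (⟨⟩-cong t h) (⟨ε⟩ t)

  mutual
    mclo-cong : ∀ t {s s'} → (∀ x → FreeIn x t → s x ≡ s' x) → mclo t s ≡ mclo t s'
    mclo-cong 𝟏 h = refl
    mclo-cong (?t t σ) h = cong (?t t) (mclo-cong σ (λ x f → h x (?t f)))
    mclo-cong (!t t σ) h = cong (!t t) (mclo-cong σ (λ x f → h x (!t f)))
    mclo-cong (?m m σ) h = cong₂ ?m (⟨⟩-cong m (λ x f → h x (?m₁ f))) (mclo-cong σ (λ x f → h x (?m₂ f)))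
    mclo-cong (!m m σ) h = cong₂ !m (⟨⟩-cong m (λ x f → h x (!m₁ f))) (mclo-cong σ (λ x f → h x (!m₂ f)))
    mclo-cong (ext b) h = cong ext (mcloₛ-cong b (λ x f → h x (ext f)))
    mclo-cong (int b) h = cong int (mcloₛ-cong b (λ x f → h x (int f)))
    mclo-cong (μ y σ) {s} {s'} h = cong (μ y) (mclo-cong σ λ x f →
      update-cong s s' y x (⟨⟩-cong (μ y σ) h) λ x≢y → h x (μ x≢y f))
    mclo-cong (var x) h = refl

    mcloₛ-cong : ∀ b {s s'} → (∀ x → FreeInSum x b → s x ≡ s' x) → mcloₛ b s ≡ mcloₛ b s'
    mcloₛ-cong (last l σ) h = cong (last l) (mclo-cong σ (λ x f → h x (last f)))
    mcloₛ-cong (cons l σ b) h =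
      cong₂ (cons l) (mclo-cong σ (λ x f → h x (cons₁ f))) (mcloₛ-cong b (λ x f → h x (cons₂ f)))

  FreeVia : Subst → (Var → Set) → Var → Set
  FreeVia s P z = ∃[ x ] ∃[ v ] P x × s x ≡ just v × FreeIn z v

  FreeVia-map : ∀ {s} {P Q : Var → Set} {z} → (∀ {x} → P x → Q x) → FreeVia s P z → FreeVia s Q z
  FreeVia-map g (x , v , p , e , f) = x , v , g p , e , f

  FreeAfter : Subst → (Var → Set) → Var → Set
  FreeAfter s P z = (P z × s z ≡ nothing) ⊎ FreeVia s P z

  FreeAfter-map : ∀ {s} {P Q : Var → Set} {z} → (∀ {x} → P x → Q x) → FreeAfter s P z → FreeAfter s Q z
  FreeAfter-map g = Sum.map (Product.map₁ g) (FreeVia-map g)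

  mutual
    fv-⟨⟩ : ∀ t s z → FreeIn z (t ⟨ s ⟩) → FreeAfter s (Fv t) z
    fv-⟨⟩ 𝟏 s z ()
    fv-⟨⟩ (?t t σ) s z (?t f) = FreeAfter-map ?t (fv-⟨⟩ σ s z f)
    fv-⟨⟩ (!t t σ) s z (!t f) = FreeAfter-map !t (fv-⟨⟩ σ s z f)
    fv-⟨⟩ (?m m σ) s z (?m₁ f) = FreeAfter-map ?m₁ (fv-⟨⟩ m s z f)
    fv-⟨⟩ (?m m σ) s z (?m₂ f) = FreeAfter-map ?m₂ (fv-⟨⟩ σ s z f)
    fv-⟨⟩ (!m m σ) s z (!m₁ f) = FreeAfter-map !m₁ (fv-⟨⟩ m s z f)
    fv-⟨⟩ (!m m σ) s z (!m₂ f) = FreeAfter-map !m₂ (fv-⟨⟩ σ s z f)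
    fv-⟨⟩ (ext b) s z (ext f) = FreeAfter-map ext (fvₛ-⟨⟩ b s z f)
    fv-⟨⟩ (int b) s z (int f) = FreeAfter-map int (fvₛ-⟨⟩ b s z f)
    fv-⟨⟩ (μ y σ) s z (μ z≢y f) with fv-⟨⟩ σ (remove s y) z f
    ... | inj₁ (fz , e) = inj₁ (μ z≢y fz , trans (sym (remove-≢ s z≢y)) e)
    ... | inj₂ (x , v , fx , e , fv) with remove-just s y x e
    ...   | x≢y , e' = inj₂ (x , v , μ x≢y fx , e' , fv)
    fv-⟨⟩ (var x) s z f with s x in e
    ... | just v = inj₂ (x , v , var , e , f)
    fv-⟨⟩ (var x) s z var | nothing = inj₁ (var , e)

    fvₛ-⟨⟩ : ∀ b s z → FreeInSum z (b ⟨ s ⟩ₛ) → FreeAfter s (Fvₛ b) z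
    fvₛ-⟨⟩ (last l σ) s z (last f) = FreeAfter-map last (fv-⟨⟩ σ s z f)
    fvₛ-⟨⟩ (cons l σ b) s z (cons₁ f) = FreeAfter-map cons₁ (fv-⟨⟩ σ s z f)
    fvₛ-⟨⟩ (cons l σ b) s z (cons₂ f) = FreeAfter-map cons₂ (fvₛ-⟨⟩ b s z f)

  mutual
    fv-mclo : ∀ t s z → FreeIn z (mclo t s) → FreeIn z t ⊎ FreeVia s (Fv t) z
    fv-mclo 𝟏 s z ()
    fv-mclo (?t t σ) s z (?t f) = Sum.map ?t (FreeVia-map ?t) (fv-mclo σ s z f)
    fv-mclo (!t t σ) s z (!t f) = Sum.map !t (FreeVia-map !t) (fv-mclo σ s z f)
    fv-mclo (?m m σ) s z (?m₁ f) = Sum.map (?m₁ ∘ proj₁) (FreeVia-map ?m₁) (fv-⟨⟩ m s z f)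
    fv-mclo (?m m σ) s z (?m₂ f) = Sum.map ?m₂ (FreeVia-map ?m₂) (fv-mclo σ s z f)
    fv-mclo (!m m σ) s z (!m₁ f) = Sum.map (!m₁ ∘ proj₁) (FreeVia-map !m₁) (fv-⟨⟩ m s z f)
    fv-mclo (!m m σ) s z (!m₂ f) = Sum.map !m₂ (FreeVia-map !m₂) (fv-mclo σ s z f)
    fv-mclo (ext b) s z (ext f) = Sum.map ext (FreeVia-map ext) (fvₛ-mclo b s z f)
    fv-mclo (int b) s z (int f) = Sum.map int (FreeVia-map int) (fvₛ-mclo b s z f)
    fv-mclo (μ y σ) s z (μ z≢y f) with fv-mclo σ (update s y (μ y σ ⟨ s ⟩)) z f
    ... | inj₁ fz = inj₁ (μ z≢y fz)
    ... | inj₂ (x , v , fx , e , fv) with update-just s y (μ y σ ⟨ s ⟩) x e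
    ...   | inj₁ (refl , refl) = Sum.map₁ proj₁ (fv-⟨⟩ (μ y σ) s z fv)
    ...   | inj₂ (x≢y , e') = inj₂ (x , v , μ x≢y fx , e' , fv)
    fv-mclo (var x) s z f = inj₁ f

    fvₛ-mclo : ∀ b s z → FreeInSum z (mcloₛ b s) → FreeInSum z b ⊎ FreeVia s (Fvₛ b) z
    fvₛ-mclo (last l σ) s z (last f) = Sum.map last (FreeVia-map last) (fv-mclo σ s z f)
    fvₛ-mclo (cons l σ b) s z (cons₁ f) = Sum.map cons₁ (FreeVia-map cons₁) (fv-mclo σ s z f)
    fvₛ-mclo (cons l σ b) s z (cons₂ f) = Sum.map cons₂ (FreeVia-map cons₂) (fvₛ-mclo b s z f)

  mutual
    fv-dual : ∀ t {x} → FreeIn x (dual t) → FreeIn x t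
    fv-dual 𝟏 ()
    fv-dual (?t t σ) (!t f) = ?t (fv-dual σ f)
    fv-dual (!t t σ) (?t f) = !t (fv-dual σ f)
    fv-dual (?m m σ) (!m₁ f) = ?m₁ f
    fv-dual (?m m σ) (!m₂ f) = ?m₂ (fv-dual σ f)
    fv-dual (!m m σ) (?m₁ f) = !m₁ f
    fv-dual (!m m σ) (?m₂ f) = !m₂ (fv-dual σ f)
    fv-dual (ext b) (int f) = ext (fvₛ-dual b f)
    fv-dual (int b) (ext f) = int (fvₛ-dual b f)
    fv-dual (μ y σ) (μ x≢y f) = μ x≢y (fv-dual σ f)
    fv-dual (var y) var = var

    fvₛ-dual : ∀ b {x} → FreeInSum x (dualₛ b) → FreeInSum x b
    fvₛ-dual (last l σ) (last f) = last (fv-dual σ f)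
    fvₛ-dual (cons l σ b) (cons₁ f) = cons₁ (fv-dual σ f)
    fvₛ-dual (cons l σ b) (cons₂ f) = cons₂ (fvₛ-dual b f)

  unguarded⇒free : ∀ {y t} → Unguarded y t → FreeIn y t
  unguarded⇒free var = var
  unguarded⇒free (μ y≢x u) = μ y≢x (unguarded⇒free u)

  unguarded-⟨⟩ : ∀ t s y → Unguarded y (t ⟨ s ⟩) → Unguarded y t ⊎ FreeVia s (Fv t) y
  unguarded-⟨⟩ 𝟏 s y ()
  unguarded-⟨⟩ (?t _ _) s y ()
  unguarded-⟨⟩ (!t _ _) s y ()
  unguarded-⟨⟩ (?m _ _) s y ()
  unguarded-⟨⟩ (!m _ _) s y ()
  unguarded-⟨⟩ (ext _) s y ()
  unguarded-⟨⟩ (int _) s y ()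
  unguarded-⟨⟩ (μ z σ) s y (μ y≢z u) with unguarded-⟨⟩ σ (remove s z) y u
  ... | inj₁ u' = inj₁ (μ y≢z u')
  ... | inj₂ (x , v , fx , e , fv) with remove-just s z x e
  ...   | x≢z , e' = inj₂ (x , v , μ x≢z fx , e' , fv)
  unguarded-⟨⟩ (var x) s y u with s x in e
  ... | just v = inj₂ (x , v , var , e , unguarded⇒free u)
  unguarded-⟨⟩ (var x) s y var | nothing = inj₁ var

  unguarded-dual : ∀ t {y} → Unguarded y (dual t) → Unguarded y t
  unguarded-dual 𝟏 ()
  unguarded-dual (?t _ _) ()
  unguarded-dual (!t _ _) ()
  unguarded-dual (?m _ _) ()
  unguarded-dual (!m _ _) ()
  unguarded-dual (ext _) ()
  unguarded-dual (int _) ()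
  unguarded-dual (μ z σ) (μ y≢z u) = μ y≢z (unguarded-dual σ u)
  unguarded-dual (var x) var = var

  unguarded-mclo : ∀ t s {y} → Unguarded y (mclo t s) → Unguarded y t
  unguarded-mclo 𝟏 s ()
  unguarded-mclo (?t _ _) s ()
  unguarded-mclo (!t _ _) s ()
  unguarded-mclo (?m _ _) s ()
  unguarded-mclo (!m _ _) s ()
  unguarded-mclo (ext _) s ()
  unguarded-mclo (int _) s ()
  unguarded-mclo (μ z σ) s (μ y≢z u) = μ y≢z (unguarded-mclo σ _ u)
  unguarded-mclo (var x) s var = var

  labels-⟨⟩ₛ : ∀ b s → labels (b ⟨ s ⟩ₛ) ≡ labels b
  labels-⟨⟩ₛ (last l σ) s = refl
  labels-⟨⟩ₛ (cons l σ b) s = cong (l ∷_) (labels-⟨⟩ₛ b s)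

  labels-dualₛ : ∀ b → labels (dualₛ b) ≡ labels b
  labels-dualₛ (last l σ) = refl
  labels-dualₛ (cons l σ b) = cong (l ∷_) (labels-dualₛ b)

  labels-mcloₛ : ∀ b s → labels (mcloₛ b s) ≡ labels b
  labels-mcloₛ (last l σ) s = refl
  labels-mcloₛ (cons l σ b) s = cong (l ∷_) (labels-mcloₛ b s)

  ClosedValues : Subst → Set
  ClosedValues s = ∀ x {v} → s x ≡ just v → Closed v

  SCValues : Subst → Set
  SCValues s = ∀ x {v} → s x ≡ just v → SC v

  SCValues⇒ClosedValues : ∀ {s} → SCValues s → ClosedValues s
  SCValues⇒ClosedValues scs x e = proj₁ (scs x e)

  Covers : Subst → Term → Set
  Covers s t = ∀ {x} → FreeIn x t → ∃ λ v → s x ≡ just v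

  SCValues-update : ∀ s y X → SCValues s → SC X → SCValues (update s y X)
  SCValues-update s y X scs scX x e with update-just s y X x e
  ... | inj₁ (_ , refl) = scX
  ... | inj₂ (_ , e') = scs x e'

  Covers-update : ∀ s y {σ} X → Covers s (μ y σ) → Covers (update s y X) σ
  Covers-update s y X cov {x} f with x ≟ y
  ... | yes refl = X , update-≡ s x X
  ... | no x≢y = Product.map₂ (trans (update-≢ s X x≢y)) (cov (μ x≢y f))

  closed-⟨⟩ : ∀ t {s} → ClosedValues s → Covers s t → Closed (t ⟨ s ⟩)
  closed-⟨⟩ t {s} cs cov z f with fv-⟨⟩ t s z f
  ... | inj₁ (fz , e) = contradiction (trans (sym (proj₂ (cov fz))) e) λ ()
  ... | inj₂ (x , _ , _ , e , fv) = cs x e z fv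

  mutual
    wf-⟨⟩ : ∀ {t s} → SCValues s → WF t → WF (t ⟨ s ⟩)
    wf-⟨⟩ scs 𝟏 = 𝟏
    wf-⟨⟩ scs (?t w) = ?t (wf-⟨⟩ scs w)
    wf-⟨⟩ scs (!t w) = !t (wf-⟨⟩ scs w)
    wf-⟨⟩ scs (?m w₁ w₂) = ?m (wf-⟨⟩ scs w₁) (wf-⟨⟩ scs w₂)
    wf-⟨⟩ scs (!m w₁ w₂) = !m (wf-⟨⟩ scs w₁) (wf-⟨⟩ scs w₂)
    wf-⟨⟩ {ext b} {s} scs (ext u w) = ext (subst Unique (sym (labels-⟨⟩ₛ b s)) u) (wfₛ-⟨⟩ scs w)
    wf-⟨⟩ {int b} {s} scs (int u w) = int (subst Unique (sym (labels-⟨⟩ₛ b s)) u) (wfₛ-⟨⟩ scs w)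
    wf-⟨⟩ {μ y σ} {s} scs (μ ng w) = μ guarded (wf-⟨⟩ scs' w)
      where
      scs' : SCValues (remove s y)
      scs' x e = scs x (proj₂ (remove-just s y x e))
      guarded : ¬ Unguarded y (σ ⟨ remove s y ⟩)
      guarded u with unguarded-⟨⟩ σ (remove s y) y u
      ... | inj₁ u' = ng u'
      ... | inj₂ (x , _ , _ , e , fv) = proj₁ (scs' x e) y fv
    wf-⟨⟩ {var x} {s} scs var with s x in e
    ... | just v = proj₂ (scs x e)
    ... | nothing = var

    wfₛ-⟨⟩ : ∀ {b s} → SCValues s → WFSum b → WFSum (b ⟨ s ⟩ₛ)
    wfₛ-⟨⟩ scs (last w) = last (wf-⟨⟩ scs w)
    wfₛ-⟨⟩ scs (cons w ws) = cons (wf-⟨⟩ scs w) (wfₛ-⟨⟩ scs ws)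

  mutual
    wf-dual : ∀ {t} → WF t → WF (dual t)
    wf-dual 𝟏 = 𝟏
    wf-dual (?t w) = !t (wf-dual w)
    wf-dual (!t w) = ?t (wf-dual w)
    wf-dual (?m w₁ w₂) = !m w₁ (wf-dual w₂)
    wf-dual (!m w₁ w₂) = ?m w₁ (wf-dual w₂)
    wf-dual {ext b} (ext u w) = int (subst Unique (sym (labels-dualₛ b)) u) (wfₛ-dual w)
    wf-dual {int b} (int u w) = ext (subst Unique (sym (labels-dualₛ b)) u) (wfₛ-dual w)
    wf-dual {μ y σ} (μ ng w) = μ (ng ∘ unguarded-dual σ) (wf-dual w)
    wf-dual var = var

    wfₛ-dual : ∀ {b} → WFSum b → WFSum (dualₛ b)
    wfₛ-dual (last w) = last (wf-dual w)
    wfₛ-dual (cons w ws) = cons (wf-dual w) (wfₛ-dual ws)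

  mutual
    wf-mclo : ∀ {t s} → SCValues s → Covers s t → WF t → WF (mclo t s)
    wf-mclo scs cov 𝟏 = 𝟏
    wf-mclo scs cov (?t w) = ?t (wf-mclo scs (cov ∘ ?t) w)
    wf-mclo scs cov (!t w) = !t (wf-mclo scs (cov ∘ !t) w)
    wf-mclo scs cov (?m w₁ w₂) = ?m (wf-⟨⟩ scs w₁) (wf-mclo scs (cov ∘ ?m₂) w₂)
    wf-mclo scs cov (!m w₁ w₂) = !m (wf-⟨⟩ scs w₁) (wf-mclo scs (cov ∘ !m₂) w₂)
    wf-mclo {ext b} {s} scs cov (ext u w) =
      ext (subst Unique (sym (labels-mcloₛ b s)) u) (wfₛ-mclo scs (cov ∘ ext) w)
    wf-mclo {int b} {s} scs cov (int u w) =
      int (subst Unique (sym (labels-mcloₛ b s)) u) (wfₛ-mclo scs (cov ∘ int) w)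
    wf-mclo {μ x σ} {s} scs cov (μ ng w) =
      μ (ng ∘ unguarded-mclo σ (update s x X))
        (wf-mclo (SCValues-update s x X scs scX) (Covers-update s x X cov) w)
      where
      X = μ x σ ⟨ s ⟩
      scX : SC X
      scX = closed-⟨⟩ (μ x σ) (SCValues⇒ClosedValues scs) cov , wf-⟨⟩ scs (μ ng w)
    wf-mclo scs cov var = var

    wfₛ-mclo : ∀ {b s} → SCValues s → (∀ {x} → FreeInSum x b → ∃ λ v → s x ≡ just v) →
               WFSum b → WFSum (mcloₛ b s)
    wfₛ-mclo scs cov (last w) = last (wf-mclo scs (cov ∘ last) w)
    wfₛ-mclo scs cov (cons w ws) = cons (wf-mclo scs (cov ∘ cons₁) w) (wfₛ-mclo scs (cov ∘ cons₂) ws)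

  dualᵐ : Term → Term
  dualᵐ ρ = dual (mcl ρ)

  SC-dualᵐ : ∀ {ρ} → SC ρ → SC (dualᵐ ρ)
  SC-dualᵐ {ρ} (c , w) = closed , wf-dual (wf-mclo (λ _ ()) (λ {x} f → ⊥-elim (c x f)) w)
    where
    closed : Closed (dualᵐ ρ)
    closed z f with fv-mclo ρ ε z (fv-dual (mcl ρ) f)
    ... | inj₁ fz = c z fz
    ... | inj₂ (_ , _ , _ , () , _)

  unfold : Var → Term → Term
  unfold x σ = σ ⟨ [ x ↦ μ x σ ] ⟩

  SC-unfold : ∀ {x σ} → SC (μ x σ) → SC (unfold x σ)
  SC-unfold {x} {σ} sc@(c , μ _ w) =
    closed-⟨⟩ σ (SCValues⇒ClosedValues scs) (Covers-update ε x (μ x σ) λ {z} f → ⊥-elim (c z f))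
    , wf-⟨⟩ scs w
    where
    scs : SCValues [ x ↦ μ x σ ]
    scs = SCValues-update ε x (μ x σ) (λ _ ()) sc

  branch-fv : ∀ {b l σ z} → b ∋ l ⇒ σ → FreeIn z σ → FreeInSum z b
  branch-fv here-last f = last f
  branch-fv here-cons f = cons₁ f
  branch-fv (there p) f = cons₂ (branch-fv p f)

  branch-wf : ∀ {b l σ} → b ∋ l ⇒ σ → WFSum b → WF σ
  branch-wf here-last (last w) = w
  branch-wf here-cons (cons w _) = w
  branch-wf (there p) (cons _ ws) = branch-wf p ws

  SC-step : ∀ {ρ α ρ'} → ρ —[ α ]→ ρ' → SC ρ → SC ρ'
  SC-step ?t (c , ?t w) = (λ z → c z ∘ ?t) , w
  SC-step !t (c , !t w) = (λ z → c z ∘ !t) , w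
  SC-step ?m (c , ?m _ w) = (λ z → c z ∘ ?m₂) , w
  SC-step !m (c , !m _ w) = (λ z → c z ∘ !m₂) , w
  SC-step !l (c , int _ (last w)) = (λ z f → c z (int (last f))) , w
  SC-step (ext p) (c , ext _ ws) = (λ z f → c z (ext (branch-fv p f))) , branch-wf p ws
  SC-step (int p) (c , int _ ws) =
    (λ { z (int (last f)) → c z (int (branch-fv p f)) }) , int ([] ∷ []) (last (branch-wf p ws))
  SC-step unf sc = SC-unfold sc

  -- Unfolding commutes with dualᵐ

  _∪_ : Subst → Subst → Subst
  (s ∪ u) x = s x <∣> u x

  mapᵛ : (Term → Term) → Subst → Subst
  mapᵛ f s x = mapᴹ f (s x)

  remove-∪ : ∀ s u y x → (remove s y ∪ remove u y) x ≡ remove (s ∪ u) y x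
  remove-∪ s u y x with x ≡ᵇ y
  ... | true = refl
  ... | false = refl

  update-∪ : ∀ s u y X x → update (s ∪ u) y X x ≡ (remove s y ∪ update u y X) x
  update-∪ s u y X x with x ≡ᵇ y
  ... | true = refl
  ... | false = refl

  remove-mapᵛ : ∀ f s y x → remove (mapᵛ f s) y x ≡ mapᵛ f (remove s y) x
  remove-mapᵛ f s y x with x ≡ᵇ y
  ... | true = refl
  ... | false = refl

  mapᵛ-↦ : ∀ f y X x → mapᵛ f [ y ↦ X ] x ≡ [ y ↦ f X ] x
  mapᵛ-↦ f y X x with x ≡ᵇ y
  ... | true = refl
  ... | false = refl

  ClosedValues-remove : ∀ s y → ClosedValues s → ClosedValues (remove s y)
  ClosedValues-remove s y cs x e = cs x (proj₂ (remove-just s y x e))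

  mutual
    ⟨⟩-⟨⟩ : ∀ t {s} u → ClosedValues s → t ⟨ s ⟩ ⟨ u ⟩ ≡ t ⟨ s ∪ u ⟩
    ⟨⟩-⟨⟩ 𝟏 u cs = refl
    ⟨⟩-⟨⟩ (?t t σ) u cs = cong (?t t) (⟨⟩-⟨⟩ σ u cs)
    ⟨⟩-⟨⟩ (!t t σ) u cs = cong (!t t) (⟨⟩-⟨⟩ σ u cs)
    ⟨⟩-⟨⟩ (?m m σ) u cs = cong₂ ?m (⟨⟩-⟨⟩ m u cs) (⟨⟩-⟨⟩ σ u cs)
    ⟨⟩-⟨⟩ (!m m σ) u cs = cong₂ !m (⟨⟩-⟨⟩ m u cs) (⟨⟩-⟨⟩ σ u cs)
    ⟨⟩-⟨⟩ (ext b) u cs = cong ext (⟨⟩ₛ-⟨⟩ₛ b u cs)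
    ⟨⟩-⟨⟩ (int b) u cs = cong int (⟨⟩ₛ-⟨⟩ₛ b u cs)
    ⟨⟩-⟨⟩ (μ y σ) {s} u cs = cong (μ y) (trans
      (⟨⟩-⟨⟩ σ (remove u y) (ClosedValues-remove s y cs))
      (⟨⟩-cong σ λ x _ → remove-∪ s u y x))
    ⟨⟩-⟨⟩ (var x) {s} u cs with s x in e
    ... | just v = ⟨⟩-identity v λ z f → ⊥-elim (cs x e z f)
    ... | nothing = refl

    ⟨⟩ₛ-⟨⟩ₛ : ∀ b {s} u → ClosedValues s → b ⟨ s ⟩ₛ ⟨ u ⟩ₛ ≡ b ⟨ s ∪ u ⟩ₛ
    ⟨⟩ₛ-⟨⟩ₛ (last l σ) u cs = cong (last l) (⟨⟩-⟨⟩ σ u cs)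
    ⟨⟩ₛ-⟨⟩ₛ (cons l σ b) u cs = cong₂ (cons l) (⟨⟩-⟨⟩ σ u cs) (⟨⟩ₛ-⟨⟩ₛ b u cs)

  ValuesAvoid : Subst → Subst → Set
  ValuesAvoid u s = ∀ y {v} z → u y ≡ just v → FreeIn z v → s z ≡ nothing

  fv-⟨⟩-⟨⟩ : ∀ t {s u z} → ClosedValues s → ValuesAvoid u s →
             FreeIn z (t ⟨ s ⟩ ⟨ u ⟩) → s z ≡ nothing
  fv-⟨⟩-⟨⟩ t {s} {u} {z} cs av f with fv-⟨⟩ (t ⟨ s ⟩) u z f
  ... | inj₂ (y , _ , _ , e , fv) = av y z e fv
  ... | inj₁ (fz , _) with fv-⟨⟩ t s z fz
  ...   | inj₁ (_ , e) = e
  ...   | inj₂ (x , _ , _ , e , fv) = ⊥-elim (cs x e z fv)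

  ValuesAvoid-update : ∀ σ {s u} y → ClosedValues s → ValuesAvoid u s →
                       ValuesAvoid (update u y (μ y σ ⟨ s ⟩ ⟨ u ⟩)) (remove s y)
  ValuesAvoid-update σ {s} {u} y cs av x z e f with update-just u y _ x e
  ... | inj₁ (_ , refl) = remove-nothing s y z (fv-⟨⟩-⟨⟩ (μ y σ) cs av f)
  ... | inj₂ (_ , e') = remove-nothing s y z (av x z e' f)

  ⟨∪⟩-⟨mapᵛ⟩ : ∀ m f {s u} → ClosedValues s → ValuesAvoid u s →
               m ⟨ s ∪ u ⟩ ⟨ mapᵛ f s ⟩ ≡ m ⟨ s ⟩ ⟨ u ⟩
  ⟨∪⟩-⟨mapᵛ⟩ m f {s} {u} cs av = begin
      m ⟨ s ∪ u ⟩ ⟨ mapᵛ f s ⟩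
    ≡⟨ cong (_⟨ mapᵛ f s ⟩) (sym (⟨⟩-⟨⟩ m u cs)) ⟩
      m ⟨ s ⟩ ⟨ u ⟩ ⟨ mapᵛ f s ⟩
    ≡⟨ ⟨⟩-identity (m ⟨ s ⟩ ⟨ u ⟩) (λ z fz → cong (mapᴹ f) (fv-⟨⟩-⟨⟩ m cs av fz)) ⟩
      m ⟨ s ⟩ ⟨ u ⟩ ∎

  -- s collects the substitutions made by unfolding, u those made by mclo beneath them;
  -- splitting them is what lets the induction pass under a μ.
  mutual
    dual-mclo-⟨⟩ : ∀ t {s u} → ClosedValues s → ValuesAvoid u s →
                   dual (mclo t (s ∪ u)) ⟨ mapᵛ dualᵐ s ⟩ ≡ dual (mclo (t ⟨ s ⟩) u)
    dual-mclo-⟨⟩ 𝟏 cs av = refl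
    dual-mclo-⟨⟩ (?t t σ) cs av = cong (!t t) (dual-mclo-⟨⟩ σ cs av)
    dual-mclo-⟨⟩ (!t t σ) cs av = cong (?t t) (dual-mclo-⟨⟩ σ cs av)
    dual-mclo-⟨⟩ (?m m σ) cs av = cong₂ !m (⟨∪⟩-⟨mapᵛ⟩ m dualᵐ cs av) (dual-mclo-⟨⟩ σ cs av)
    dual-mclo-⟨⟩ (!m m σ) cs av = cong₂ ?m (⟨∪⟩-⟨mapᵛ⟩ m dualᵐ cs av) (dual-mclo-⟨⟩ σ cs av)
    dual-mclo-⟨⟩ (ext b) cs av = cong int (dualₛ-mcloₛ-⟨⟩ₛ b cs av)
    dual-mclo-⟨⟩ (int b) cs av = cong ext (dualₛ-mcloₛ-⟨⟩ₛ b cs av)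
    dual-mclo-⟨⟩ (μ y σ) {s} {u} cs av = cong (μ y) (begin
        dual (mclo σ (update (s ∪ u) y (μ y σ ⟨ s ∪ u ⟩))) ⟨ remove (mapᵛ dualᵐ s) y ⟩
      ≡⟨ cong (λ t → dual t ⟨ remove (mapᵛ dualᵐ s) y ⟩) (mclo-cong σ λ x _ → update-split x) ⟩
        dual (mclo σ (s₁ ∪ u₁)) ⟨ remove (mapᵛ dualᵐ s) y ⟩
      ≡⟨ ⟨⟩-cong (dual (mclo σ (s₁ ∪ u₁))) (λ x _ → remove-mapᵛ dualᵐ s y x) ⟩
        dual (mclo σ (s₁ ∪ u₁)) ⟨ mapᵛ dualᵐ s₁ ⟩
      ≡⟨ dual-mclo-⟨⟩ σ (ClosedValues-remove s y cs) (ValuesAvoid-update σ y cs av) ⟩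
        dual (mclo (σ ⟨ s₁ ⟩) u₁) ∎)
      where
      s₁ = remove s y
      u₁ = update u y (μ y σ ⟨ s ⟩ ⟨ u ⟩)
      update-split : ∀ x → update (s ∪ u) y (μ y σ ⟨ s ∪ u ⟩) x ≡ (s₁ ∪ u₁) x
      update-split x = trans (cong (λ X → update (s ∪ u) y X x) (sym (⟨⟩-⟨⟩ (μ y σ) u cs)))
                             (update-∪ s u y _ x)
    dual-mclo-⟨⟩ (var x) {s} {u} cs av with s x in e
    ... | just v = cong dual (mclo-cong v λ z f → ⊥-elim (cs x e z f))
    ... | nothing = refl

    dualₛ-mcloₛ-⟨⟩ₛ : ∀ b {s u} → ClosedValues s → ValuesAvoid u s →
                      dualₛ (mcloₛ b (s ∪ u)) ⟨ mapᵛ dualᵐ s ⟩ₛ ≡ dualₛ (mcloₛ (b ⟨ s ⟩ₛ) u)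
    dualₛ-mcloₛ-⟨⟩ₛ (last l σ) cs av = cong (last l) (dual-mclo-⟨⟩ σ cs av)
    dualₛ-mcloₛ-⟨⟩ₛ (cons l σ b) cs av = cong₂ (cons l) (dual-mclo-⟨⟩ σ cs av) (dualₛ-mcloₛ-⟨⟩ₛ b cs av)

  dualᵐ-unfold : ∀ {x σ δ} → Closed (μ x σ) → dualᵐ (μ x σ) —[ τ ]→ δ → δ ≡ dualᵐ (unfold x σ)
  dualᵐ-unfold {x} {σ} c unf = begin
      dual (mclo σ (update ε x (μ x σ ⟨ ε ⟩))) ⟨ [ x ↦ dualᵐ (μ x σ) ] ⟩
    ≡⟨ cong (λ t → dual t ⟨ [ x ↦ dualᵐ (μ x σ) ] ⟩) (mclo-cong σ λ z _ → closure-value z) ⟩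
      dual (mclo σ (s ∪ ε)) ⟨ [ x ↦ dualᵐ (μ x σ) ] ⟩
    ≡⟨ ⟨⟩-cong (dual (mclo σ (s ∪ ε))) (λ z _ → sym (mapᵛ-↦ dualᵐ x (μ x σ) z)) ⟩
      dual (mclo σ (s ∪ ε)) ⟨ mapᵛ dualᵐ s ⟩
    ≡⟨ dual-mclo-⟨⟩ σ cs (λ _ _ ()) ⟩
      dual (mclo (σ ⟨ s ⟩) ε) ∎
    where
    s = [ x ↦ μ x σ ]
    cs : ClosedValues s
    cs z e rewrite ↦-just x (μ x σ) z e = c
    closure-value : ∀ z → update ε x (μ x σ ⟨ ε ⟩) z ≡ (s ∪ ε) z
    closure-value z = trans (cong (λ X → update ε x X z) (⟨ε⟩ (μ x σ))) (sym (<∣>-identityʳ (s z)))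

  data _⇝*_ : Term → Term → Set where
    done      : ∀ {ρ} → ρ ⇝* ρ
    next      : ∀ {x σ ρ} → unfold x σ ⇝* ρ → μ x σ ⇝* ρ

  ⇝*-snoc : ∀ {ρ x σ} → ρ ⇝* μ x σ → ρ ⇝* unfold x σ
  ⇝*-snoc done = next done
  ⇝*-snoc (next u) = next (⇝*-snoc u)

  Connected : Term → Term → Set
  Connected ρ ρ₂ = ρ ⇝* ρ₂ ⊎ ρ₂ ⇝* ρ

  Connected-unfold : ∀ {ρ x σ} → Connected ρ (μ x σ) → Connected ρ (unfold x σ)
  Connected-unfold (inj₁ u) = inj₁ (⇝*-snoc u)
  Connected-unfold (inj₂ done) = inj₁ (next done)
  Connected-unfold (inj₂ (next u)) = inj₂ u

  Connected-ext : ∀ {ρ b} → Connected ρ (ext b) → ρ ⇝* ext b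
  Connected-ext (inj₁ u) = u
  Connected-ext (inj₂ done) = done

  branch-dualᵐ : ∀ {b l σ} → b ∋ l ⇒ σ → dualₛ (mcloₛ b ε) ∋ l ⇒ dualᵐ σ
  branch-dualᵐ here-last = here-last
  branch-dualᵐ here-cons = here-cons
  branch-dualᵐ (there p) = there (branch-dualᵐ p)

  branch-dualᵐ⁻¹ : ∀ b {l δ} → dualₛ (mcloₛ b ε) ∋ l ⇒ δ → ∃ λ σ → b ∋ l ⇒ σ × δ ≡ dualᵐ σ
  branch-dualᵐ⁻¹ (last l σ) here-last = σ , here-last , refl
  branch-dualᵐ⁻¹ (cons l σ b) here-cons = σ , here-cons , refl
  branch-dualᵐ⁻¹ (cons l σ b) (there p) = Product.map₂ (Product.map₁ there) (branch-dualᵐ⁻¹ b p)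

  branch-label : ∀ {b l σ} → b ∋ l ⇒ σ → l ∈ labels b
  branch-label here-last = here refl
  branch-label here-cons = here refl
  branch-label (there p) = there (branch-label p)

  branch-unique : ∀ {b l σ σ'} → Unique (labels b) → b ∋ l ⇒ σ → b ∋ l ⇒ σ' → σ ≡ σ'
  branch-unique _ here-last here-last = refl
  branch-unique _ here-cons here-cons = refl
  branch-unique (l∉ ∷ _) here-cons (there q) = contradiction refl (All-lookup l∉ (branch-label q))
  branch-unique (l∉ ∷ _) (there p) here-cons = contradiction refl (All-lookup l∉ (branch-label p))
  branch-unique (_ ∷ uq) (there p) (there q) = branch-unique uq p q

  module Compliance (B : Term → Term → Set)
                    (≤ₜ-refl : ∀ {t} → t ≤ₜ t)
                    (B-refl : ∀ {σ} → SC σ → B σ σ) where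

    -- ρ and the dual of ρ₂ only drift apart by unfoldings, or by one side
    -- having committed to a branch that the other has not yet matched.
    data Related : Term → Term → Set where
      connected : ∀ {ρ ρ₂} → SC ρ₂ → Connected ρ ρ₂ → Related ρ (dualᵐ ρ₂)
      committed : ∀ {ρ₂ b l σ} → SC ρ₂ → ρ₂ ⇝* int b → b ∋ l ⇒ σ →
                  Related (int (last l σ)) (dualᵐ ρ₂)
      answered  : ∀ {ρ b l σ} → ρ ⇝* ext b → b ∋ l ⇒ σ →
                  Related ρ (int (last l (dualᵐ σ)))

    dual-sync : ∀ {ρ ρ' δ' a a'} → SC ρ → ρ —[ a ]→ ρ' → dualᵐ ρ —[ a' ]→ δ' → Match B a a' →
                Related ρ' δ'
    dual-sync sc ?t !t _ = connected (SC-step ?t sc) (inj₁ done)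
    dual-sync sc !t ?t _ = connected (SC-step !t sc) (inj₁ done)
    dual-sync sc ?m !m _ = connected (SC-step ?m sc) (inj₁ done)
    dual-sync sc !m ?m _ = connected (SC-step !m sc) (inj₁ done)
    dual-sync sc !l (ext here-last) _ = connected (SC-step !l sc) (inj₁ done)
    dual-sync {ext (last l σ)} sc (ext here-last) !l _ =
      connected (SC-step (ext here-last) sc) (inj₁ done)
    dual-sync {ext (cons _ _ _)} sc (ext _) (int _) ()
    dual-sync sc (int _) _ ()
    dual-sync sc unf _ ()

    connected-left : ∀ {ρ ρ' ρ₂} → SC ρ₂ → Connected ρ ρ₂ → ρ —[ τ ]→ ρ' → Related ρ' (dualᵐ ρ₂)
    connected-left sc₂ (inj₁ done) unf = connected sc₂ (inj₂ (next done))
    connected-left sc₂ (inj₁ (next u)) unf = connected sc₂ (inj₁ u)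
    connected-left sc₂ (inj₂ u) unf = connected sc₂ (inj₂ (⇝*-snoc u))
    connected-left sc₂ (inj₁ done) (int p) = committed sc₂ done p
    connected-left sc₂ (inj₂ u) (int p) = committed sc₂ u p

    connected-right : ∀ {ρ δ'} ρ₂ → SC ρ₂ → Connected ρ ρ₂ → dualᵐ ρ₂ —[ τ ]→ δ' → Related ρ δ'
    connected-right (μ x σ) sc₂ conn s rewrite dualᵐ-unfold (proj₁ sc₂) s =
      connected (SC-unfold sc₂) (Connected-unfold conn)
    connected-right (ext (cons l σ b)) sc₂ conn (int p) with branch-dualᵐ⁻¹ (cons l σ b) p
    ... | _ , q , refl = answered (Connected-ext conn) q
    connected-right 𝟏 _ _ ()
    connected-right (?t _ _) _ _ ()
    connected-right (!t _ _) _ _ ()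
    connected-right (?m _ _) _ _ ()
    connected-right (!m _ _) _ _ ()
    connected-right (ext (last _ _)) _ _ ()
    connected-right (int _) _ _ ()
    connected-right (var _) _ _ ()

    connected-sync : ∀ {ρ ρ' δ' a a' ρ₂} → SC ρ → Connected ρ ρ₂ →
                     ρ —[ a ]→ ρ' → dualᵐ ρ₂ —[ a' ]→ δ' → Match B a a' → Related ρ' δ'
    connected-sync sc (inj₁ done) s s₂ m = dual-sync sc s s₂ m
    connected-sync sc (inj₂ done) s s₂ m = dual-sync sc s s₂ m
    connected-sync sc (inj₁ (next _)) unf _ ()
    connected-sync sc (inj₂ (next _)) _ unf ()

    committed-right : ∀ {b l σ δ'} ρ₂ → SC ρ₂ → ρ₂ ⇝* int b → b ∋ l ⇒ σ →
                      dualᵐ ρ₂ —[ τ ]→ δ' → Related (int (last l σ)) δ'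
    committed-right (μ x σ) sc₂ (next u) p s rewrite dualᵐ-unfold (proj₁ sc₂) s =
      committed (SC-unfold sc₂) u p
    committed-right (int _) _ done _ ()

    committed-sync : ∀ {b l σ δ' a} → SC (int (last l σ)) → ∀ ρ₂ → SC ρ₂ → ρ₂ ⇝* int b →
                     b ∋ l ⇒ σ → dualᵐ ρ₂ —[ a ]→ δ' → Match B (outL l) a → Related σ δ'
    committed-sync sc (μ _ _) _ _ _ unf ()
    committed-sync sc (int b) (_ , int uq _) done p (ext q) !l?l with branch-dualᵐ⁻¹ b q
    ... | _ , q' , refl with branch-unique uq p q'
    ...   | refl = connected (SC-step !l sc) (inj₁ done)

    answered-left : ∀ {ρ ρ' b l σ} → ρ ⇝* ext b → b ∋ l ⇒ σ → ρ —[ τ ]→ ρ' →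
                    Related ρ' (int (last l (dualᵐ σ)))
    answered-left (next u) p unf = answered u p
    answered-left done _ ()

    answered-sync : ∀ {ρ ρ' b l σ} → SC ρ → ρ ⇝* ext b → b ∋ l ⇒ σ → ρ —[ inL l ]→ ρ' →
                    Related ρ' (dualᵐ σ)
    answered-sync sc@(_ , ext uq _) done p (ext q) with branch-unique uq p q
    ... | refl = connected (SC-step (ext q) sc) (inj₁ done)
    answered-sync sc (next _) _ ()

    Related-step : ∀ {ρ δ ρ' δ'} → SC ρ → Related ρ δ → PairStep B ρ δ ρ' δ' → Related ρ' δ'
    Related-step sc (connected sc₂ conn) (left s) = connected-left sc₂ conn s
    Related-step sc (connected {ρ₂ = ρ₂} sc₂ conn) (right s) = connected-right ρ₂ sc₂ conn s
    Related-step sc (connected sc₂ conn) (sync s s₂ m) = connected-sync sc conn s s₂ m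
    Related-step sc (committed sc₂ u p) (left ())
    Related-step sc (committed {ρ₂} sc₂ u p) (right s) = committed-right ρ₂ sc₂ u p s
    Related-step sc (committed {ρ₂} sc₂ u p) (sync !l s₂ m) = committed-sync sc ρ₂ sc₂ u p s₂ m
    Related-step sc (answered u p) (left s) = answered-left u p s
    Related-step sc (answered u p) (right ())
    Related-step sc (answered u p) (sync s !l ?l!l) = answered-sync sc u p s

    Progress : Term → Term → Set
    Progress ρ δ = (CanOk ρ × CanOk δ) ⊎ ∃₂ λ ρ' δ' → PairStep B ρ δ ρ' δ'

    dual-progress : ∀ ρ → SC ρ → Progress ρ (dualᵐ ρ)
    dual-progress 𝟏 _ = inj₁ (ok , ok)
    dual-progress (?t t σ) _ = inj₂ (_ , _ , sync ?t !t (?t!t ≤ₜ-refl))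
    dual-progress (!t t σ) _ = inj₂ (_ , _ , sync !t ?t (!t?t ≤ₜ-refl))
    dual-progress (?m m σ) (c , ?m wm _) = inj₂ (_ , _ , sync ?m !m (?m!m B-m⟨ε⟩-m))
      where
      B-m⟨ε⟩-m : B (m ⟨ ε ⟩) m
      B-m⟨ε⟩-m rewrite ⟨ε⟩ m = B-refl ((λ z f → c z (?m₁ f)) , wm)
    dual-progress (!m m σ) (c , !m wm _) = inj₂ (_ , _ , sync !m ?m (!m?m B-m-m⟨ε⟩))
      where
      B-m-m⟨ε⟩ : B m (m ⟨ ε ⟩)
      B-m-m⟨ε⟩ rewrite ⟨ε⟩ m = B-refl ((λ z f → c z (!m₁ f)) , wm)
    dual-progress (ext (last l σ)) _ = inj₂ (_ , _ , sync (ext here-last) !l ?l!l)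
    dual-progress (ext (cons l σ b)) _ = inj₂ (_ , _ , right (int here-cons))
    dual-progress (int (last l σ)) _ = inj₂ (_ , _ , sync !l (ext here-last) !l?l)
    dual-progress (int (cons l σ b)) _ = inj₂ (_ , _ , left (int here-cons))
    dual-progress (μ x σ) _ = inj₂ (_ , _ , left unf)
    dual-progress (var x) (c , _) = ⊥-elim (c x var)

    Related-progress : ∀ {ρ δ} → SC ρ → Related ρ δ → Progress ρ δ
    Related-progress sc (connected _ (inj₁ done)) = dual-progress _ sc
    Related-progress sc (connected _ (inj₂ done)) = dual-progress _ sc
    Related-progress sc (connected _ (inj₁ (next _))) = inj₂ (_ , _ , left unf)
    Related-progress sc (connected _ (inj₂ (next _))) = inj₂ (_ , _ , right unf)
    Related-progress sc (committed _ done p) = inj₂ (_ , _ , sync !l (ext (branch-dualᵐ p)) !l?l)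
    Related-progress sc (committed _ (next _) _) = inj₂ (_ , _ , right unf)
    Related-progress sc (answered done p) = inj₂ (_ , _ , sync (ext p) !l ?l!l)
    Related-progress sc (answered (next _) _) = inj₂ (_ , _ , left unf)

    SC-pair-step : ∀ {ρ δ ρ' δ'} → SC ρ → SC δ → PairStep B ρ δ ρ' δ' → SC ρ' × SC δ'
    SC-pair-step sc scδ (left s) = SC-step s sc , scδ
    SC-pair-step sc scδ (right s) = sc , SC-step s scδ
    SC-pair-step sc scδ (sync s s₂ _) = SC-step s sc , SC-step s₂ scδ

    Invariant : Term → Term → Set
    Invariant ρ δ = SC ρ × SC δ × Related ρ δ

    Invariant-compliance : IsCompliance B Invariant
    Invariant-compliance (sc , scδ , r) = (sc , scδ) , stuck⇒ok , preserved
      where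
      stuck⇒ok : (∀ ρ' δ' → ¬ PairStep B _ _ ρ' δ') → CanOk _ × CanOk _
      stuck⇒ok stuck with Related-progress sc r
      ... | inj₁ oks = oks
      ... | inj₂ (_ , _ , p) = ⊥-elim (stuck _ _ p)
      preserved : ∀ {ρ' δ'} → PairStep B _ _ ρ' δ' → Invariant ρ' δ'
      preserved p = let sc' , scδ' = SC-pair-step sc scδ p in sc' , scδ' , Related-step sc r p

    dual-compliance : ∀ {ρ} → SC ρ → ρ ⊨[ B ] dualᵐ ρ
    dual-compliance sc = Invariant , Invariant-compliance , sc , SC-dualᵐ sc , connected sc (inj₁ done)

theorem5p17 : (BT : Set) (_≤ₜ_ : BT → BT → Set) → IsPreorder _≡_ _≤ₜ_ →
    let open Contracts BT _≤ₜ_ in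
    (B : Term → Term → Set) → IsPreorderOnSC B →
    (ρ : Term) → SC ρ → ρ ⊨[ B ] dual (mcl ρ)
theorem5p17 BT _≤ₜ_ ≤ₜ-preorder B (_ , B-refl , _) ρ =
  Duality.Compliance.dual-compliance BT _≤ₜ_ B (IsPreorder.refl ≤ₜ-preorder) B-refl
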